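{- Let $G$ be a graph, and let $G'$ be the graph obtained from $G$ by subdividing each edge exactly once. Then $\chi'_{\mathrm{inj}}(G')\ge \log_2\chi(G)$.
   Context: All graphs are finite and simple; $\chi(G)$ is the chromatic number. An injective edge-coloring of a graph $H$ is a function $\psi:E(H)\to\mathbb N$ such that whenever $\psi(e)=\psi(e')$ for distinct edges $e,e'$, no third edge of $H$ joins an endpoint of $e$ to an endpoint of $e'$. The injective chromatic index $\chi'_{\mathrm{inj}}(H)$ is the minimum $k$ such that $H$ has an injective edge-coloring with colors in $\{1,\dots,k\}$. -}

module Defs where

open import Data.Nat using (ℕ; _≤_)
open import Data.Bool using (Bool; true; false; _∨_)
open import Data.Fin using (Fin) renaming (_<_ to _<ᶠ_)
open import Data.Fin.Properties using () renaming (_≟_ to _≟ᶠ_)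
open import Data.Sum using (_⊎_; inj₁; inj₂)
open import Data.Product using (Σ; _×_; _,_)
open import Relation.Binary.PropositionalEquality using (_≡_)
open import Relation.Nullary using (¬_)
open import Relation.Nullary.Decidable using (⌊_⌋)

record Graph (V : Set) : Set where
  field
    adj    : V → V → Bool
    sym    : ∀ u v → adj u v ≡ adj v u
    irrefl : ∀ v → adj v v ≡ false
open Graph public

Adj : ∀ {V} → Graph V → V → V → Set
Adj G u v = adj G u v ≡ true

Colorable : ∀ {n} → Graph (Fin n) → ℕ → Set
Colorable {n} G k = Σ (Fin n → Fin k) λ f → ∀ u v → Adj G u v → ¬ (f u ≡ f v)

IsChromaticNumber : ∀ {n} → Graph (Fin n) → ℕ → Set
IsChromaticNumber G c = Colorable G c × (∀ k → Colorable G k → c ≤ k)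

SamePair : ∀ {V : Set} → V → V → V → V → Set
SamePair x y a b = (x ≡ a × y ≡ b) ⊎ (x ≡ b × y ≡ a)

-- Injective edge colouring with colours {1..k}: ψ assigns a colour to each
-- (ordered) vertex pair; only its values on edges matter, and it must be
-- symmetric on edges so that it is a function of the (unordered) edge.
-- If distinct edges {a,b}, {c,d} get the same colour, then every edge joining an
-- endpoint of {a,b} to an endpoint of {c,d} is one of these two edges
-- (i.e. no third edge joins them).
InjEdgeColorable : ∀ {V} → Graph V → ℕ → Set
InjEdgeColorable {V} H k =
  Σ (V → V → Fin k) λ ψ →
    (∀ u v → Adj H u v → ψ u v ≡ ψ v u) ×
    (∀ a b c d → Adj H a b → Adj H c d → ¬ SamePair a b c d → ψ a b ≡ ψ c d →
       ∀ x y → (x ≡ a ⊎ x ≡ b) → (y ≡ c ⊎ y ≡ d) → Adj H x y →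
       SamePair x y a b ⊎ SamePair x y c d)

IsInjChromaticIndex : ∀ {V} → Graph V → ℕ → Set
IsInjChromaticIndex H c = InjEdgeColorable H c × (∀ k → InjEdgeColorable H k → c ≤ k)

Edge : ∀ {n} → Graph (Fin n) → Set
Edge {n} G = Σ (Fin n) λ u → Σ (Fin n) λ v → (u <ᶠ v) × Adj G u v

SubV : ∀ {n} → Graph (Fin n) → Set
SubV {n} G = Fin n ⊎ Edge G

incident : ∀ {n} {G : Graph (Fin n)} → Fin n → Edge G → Bool
incident w (u , v , _ , _) = ⌊ w ≟ᶠ u ⌋ ∨ ⌊ w ≟ᶠ v ⌋

subAdj : ∀ {n} (G : Graph (Fin n)) → SubV G → SubV G → Bool
subAdj G (inj₁ w) (inj₁ w') = false
subAdj G (inj₁ w) (inj₂ e)  = incident {G = G} w e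
subAdj G (inj₂ e) (inj₁ w)  = incident {G = G} w e
subAdj G (inj₂ e) (inj₂ e') = false

subAdj-sym : ∀ {n} (G : Graph (Fin n)) u v → subAdj G u v ≡ subAdj G v u
subAdj-sym G (inj₁ w) (inj₁ w') = Relation.Binary.PropositionalEquality.refl
subAdj-sym G (inj₁ w) (inj₂ e)  = Relation.Binary.PropositionalEquality.refl
subAdj-sym G (inj₂ e) (inj₁ w)  = Relation.Binary.PropositionalEquality.refl
subAdj-sym G (inj₂ e) (inj₂ e') = Relation.Binary.PropositionalEquality.refl

subAdj-irrefl : ∀ {n} (G : Graph (Fin n)) v → subAdj G v v ≡ false
subAdj-irrefl G (inj₁ w) = Relation.Binary.PropositionalEquality.refl
subAdj-irrefl G (inj₂ e) = Relation.Binary.PropositionalEquality.refl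

subdivide : ∀ {n} (G : Graph (Fin n)) → Graph (SubV G)
subdivide G = record { adj = subAdj G ; sym = subAdj-sym G ; irrefl = subAdj-irrefl G }

-- Given an injective edge colouring ψ of the subdivision G' with k colours, give
-- each vertex v of G the set of colours ψ(v, e) of the subdivided edges e = vw
-- with v < w; these are subsets of {1..k}, so there are at most 2^k of them.
-- Adjacent vertices u < v receive different sets: the colour α of the half-edge
-- (u, uv) lies in the set of u, and if some half-edge (v, vw) with v < w also had
-- colour α, the half-edge (uv, v) would be a third edge joining the two.
module Submission where

open import Defs
open import Data.Nat using (ℕ; _≤_; _^_)
open import Data.Fin using (Fin; zero; suc; funToFin; finToFun) renaming (_<_ to _<ᶠ_)
open import Data.Fin.Properties
  using (<-cmp; any?; <-irrelevant; <-irrefl; finToFun-funToFin; _<?_) renaming (_≟_ to _≟ᶠ_)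
open import Data.Bool using (true; _∨_)
open import Data.Bool.Properties using (∨-zeroʳ) renaming (_≟_ to _≟ᵇ_)
open import Data.Sum using (_⊎_; inj₁; inj₂)
open import Data.Product using (Σ; ∃; _,_; proj₁; proj₂)
open import Relation.Binary using (tri<; tri≈; tri>)
open import Relation.Binary.PropositionalEquality
  using (_≡_; refl; trans; cong; subst; module ≡-Reasoning) renaming (sym to sym≡)
open import Relation.Nullary using (¬_; Dec; yes; no; contradiction)
open import Relation.Nullary.Decidable using (⌊_⌋; dec-true; isYes≗does)
open import Axiom.UniquenessOfIdentityProofs using (module Decidable⇒UIP)

private
  variable
    n k : ℕ

adjacent-wlog-< : (G : Graph (Fin n)) (P : Fin n → Fin n → Set) →
  (∀ {u v} → P u v → P v u) → (∀ {u v} → u <ᶠ v → Adj G u v → P u v) →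
  ∀ {u v} → Adj G u v → P u v
adjacent-wlog-< G P P-sym P-< {u} {v} uv with <-cmp u v
... | tri< u<v _ _ = P-< u<v uv
... | tri> _ _ v<u = P-sym (P-< v<u (trans (Graph.sym G v u) uv))
... | tri≈ _ refl _ = contradiction (trans (sym≡ (irrefl G u)) uv) λ ()

colorable-by-subsets : (G : Graph (Fin n)) (S : Fin n → Fin k → Fin 2) →
  (∀ {u v} → Adj G u v → ¬ (∀ α → S u α ≡ S v α)) → Colorable G (2 ^ k)
colorable-by-subsets G S S-proper = (λ v → funToFin (S v)) , λ u v uv Su≡Sv →
  S-proper uv λ α → begin
    S u α                       ≡⟨ sym≡ (finToFun-funToFin (S u) α) ⟩
    finToFun (funToFin (S u)) α ≡⟨ cong (λ c → finToFun c α) Su≡Sv ⟩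
    finToFun (funToFin (S v)) α ≡⟨ finToFun-funToFin (S v) α ⟩
    S v α                       ∎
  where open ≡-Reasoning

indicator : {P : Set} → Dec P → Fin 2
indicator (yes _) = zero
indicator (no _)  = suc zero

indicator-reflects : {P Q : Set} (p : Dec P) (q : Dec Q) → indicator p ≡ indicator q → P → Q
indicator-reflects _       (yes y) _  _ = y
indicator-reflects (yes _) (no _)  () _
indicator-reflects (no ¬x) (no _)  _  x = contradiction x ¬x

edge-irrelevant : (G : Graph (Fin n)) {u v : Fin n} (p p′ : u <ᶠ v) (q q′ : Adj G u v) →
  _≡_ {A = Edge G} (u , v , p , q) (u , v , p′ , q′)
edge-irrelevant G p p′ q q′
  rewrite <-irrelevant p p′ | Decidable⇒UIP.≡-irrelevant _≟ᵇ_ q q′ = refl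

⌊≟⌋-refl : (i : Fin n) → ⌊ i ≟ᶠ i ⌋ ≡ true
⌊≟⌋-refl i = trans (isYes≗does (i ≟ᶠ i)) (dec-true (i ≟ᶠ i) refl)

tail-incident : (G : Graph (Fin n)) (e : Edge G) → Adj (subdivide G) (inj₁ (proj₁ e)) (inj₂ e)
tail-incident G (u , v , _ , _) = cong (_∨ ⌊ u ≟ᶠ v ⌋) (⌊≟⌋-refl u)

head-incident : (G : Graph (Fin n)) (e : Edge G) → Adj (subdivide G) (inj₁ (proj₁ (proj₂ e))) (inj₂ e)
head-incident G (u , v , _ , _) = trans (cong (⌊ v ≟ᶠ u ⌋ ∨_) (⌊≟⌋-refl v)) (∨-zeroʳ _)

module ForwardColours {G : Graph (Fin n)} (col : InjEdgeColorable (subdivide G) k) where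

  ψ : SubV G → SubV G → Fin k
  ψ = proj₁ col

  ForwardColourVia : Fin n → Fin k → Fin n → Set
  ForwardColourVia v α w = Σ (v <ᶠ w) λ p → Σ (Adj G v w) λ q → ψ (inj₁ v) (inj₂ (v , w , p , q)) ≡ α

  ForwardColour : Fin n → Fin k → Set
  ForwardColour v α = ∃ (ForwardColourVia v α)

  forwardColourVia? : ∀ v α w → Dec (ForwardColourVia v α w)
  forwardColourVia? v α w with v <? w | adj G v w ≟ᵇ true
  ... | no v≮w | _     = no λ (p , _) → v≮w p
  ... | yes _  | no ¬q = no λ (_ , q , _) → ¬q q
  ... | yes p  | yes q with ψ (inj₁ v) (inj₂ (v , w , p , q)) ≟ᶠ α
  ...   | yes r = yes (p , q , r)
  ...   | no ¬r = no λ (p′ , q′ , r′) →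
            ¬r (subst (λ e → ψ (inj₁ v) (inj₂ e) ≡ α) (edge-irrelevant G p′ p q′ q) r′)

  forwardColour? : ∀ v α → Dec (ForwardColour v α)
  forwardColour? v α = any? (forwardColourVia? v α)

  tail-has-forwardColour : ∀ {u v} (p : u <ᶠ v) (q : Adj G u v) →
    ForwardColour u (ψ (inj₁ u) (inj₂ (u , v , p , q)))
  tail-has-forwardColour {v = v} p q = v , p , q , refl

  head-lacks-forwardColour : ∀ {u v} (p : u <ᶠ v) (q : Adj G u v) →
    ¬ ForwardColour v (ψ (inj₁ u) (inj₂ (u , v , p , q)))
  head-lacks-forwardColour {u} {v} p q (w , p′ , q′ , r)
    with proj₂ (proj₂ col) (inj₁ u) (inj₂ e) (inj₁ v) (inj₂ e′)
           (tail-incident G e) (tail-incident G e′) distinct (sym≡ r)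
           (inj₂ e) (inj₁ v) (inj₂ refl) (inj₁ refl) (head-incident G e)
    where
    e e′ : Edge G
    e  = u , v , p , q
    e′ = v , w , p′ , q′
    distinct : ¬ SamePair (inj₁ u) (inj₂ e) (inj₁ v) (inj₂ e′)
    distinct (inj₁ (refl , _)) = <-irrefl refl p
    distinct (inj₂ (() , _))
  -- The half-edge (uv, v) equals (u, uv) only if v ≡ u, and equals (v, vw) only if uv ≡ vw, so u ≡ v.
  ... | inj₁ (inj₁ (() , _))
  ... | inj₁ (inj₂ (_ , refl)) = <-irrefl refl p
  ... | inj₂ (inj₁ (() , _))
  ... | inj₂ (inj₂ (refl , _)) = <-irrefl refl p

  colourSet : Fin n → Fin k → Fin 2
  colourSet v α = indicator (forwardColour? v α)

  colourSet-proper : ∀ {u v} → Adj G u v → ¬ (∀ α → colourSet u α ≡ colourSet v α)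
  colourSet-proper = adjacent-wlog-< G (λ u v → ¬ (∀ α → colourSet u α ≡ colourSet v α))
    (λ ¬same same → ¬same λ α → sym≡ (same α))
    λ {u} {v} p q same → let α = ψ (inj₁ u) (inj₂ (u , v , p , q)) in
      head-lacks-forwardColour p q (indicator-reflects (forwardColour? u α) (forwardColour? v α)
                                      (same α) (tail-has-forwardColour p q))

proposition2p5 : ∀ (n : ℕ) (G : Graph (Fin n)) (c k : ℕ) →
    IsChromaticNumber G c → IsInjChromaticIndex (subdivide G) k → c ≤ 2 ^ k
proposition2p5 n G c k (_ , χ-minimal) (col , _) =
  χ-minimal (2 ^ k) (colorable-by-subsets G colourSet colourSet-proper)
  where open ForwardColours col
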